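{- In the Broadcast CONGEST model there is a deterministic algorithm that solves the all-pairs reachability problem in one round on every directed graph $G$ whose underlying undirected graph has diameter $1$.
   Context: Broadcast CONGEST model: a synchronous network of $n$ processors whose communication graph $N$ is the underlying undirected graph of the input directed graph $G$ (communication is bidirectional regardless of edge directions). Each vertex has a unique $O(\log n)$-bit identifier known to itself and its neighbours in $N$, and initially knows its own incoming and outgoing edges in $G$. In each round every vertex receives the messages sent to it in the previous round, performs unbounded local computation, and then sends one and the same message of $O(\log n)$ bits to all of its neighbours in $N$. The complexity is the number of rounds. Directed graphs are simple (no self-loops or multiple edges, anti-parallel edges allowed). The underlying diameter of a directed graph is the diameter of its underlying undirected graph; underlying diameter $1$ means that for every two distinct vertices at least one of the two directed edges between them is present. In the all-pairs reachability problem each vertex must determine, for every ordered pair $(x,y)$ of vertices, whether there is a directed path from $x$ to $y$ in $G$. -}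

module Defs where

open import Data.Nat using (ℕ; suc; _^_; _<_; _≤_)
open import Data.Nat.Properties using (_≟_)
open import Data.Fin using (Fin)
open import Data.Fin.Properties using (any?)
open import Data.Bool using (Bool; true; false; _∨_; if_then_else_)
open import Data.Maybe using (Maybe; just; nothing; maybe)
open import Data.Product using (_×_; _,_; ∃)
open import Data.Sum using (_⊎_)
open import Relation.Nullary using (yes; no; ¬_)
open import Relation.Binary.PropositionalEquality using (_≡_; _≢_)
open import Relation.Binary.Construct.Closure.ReflexiveTransitive using (Star)
open import Function.Definitions using (Injective)

-- A directed graph on vertex set Fin n, given by its adjacency predicate:
-- E u v ≡ true iff the directed edge u → v is present.
Digraph : ℕ → Set
Digraph n = Fin n → Fin n → Bool

-- simple: no self-loops (multiple edges are impossible with a Bool adjacency;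
-- anti-parallel edges are allowed)
Simple : {n : ℕ} → Digraph n → Set
Simple {n} E = (v : Fin n) → E v v ≡ false

-- underlying undirected graph has diameter exactly 1:
-- at least two vertices, and every two distinct vertices are joined by an edge
-- in at least one direction
UnderlyingDiameter1 : {n : ℕ} → Digraph n → Set
UnderlyingDiameter1 {n} E =
  (2 ≤ n) × ((u v : Fin n) → u ≢ v → (E u v ≡ true) ⊎ (E v u ≡ true))

Reachable : {n : ℕ} → Digraph n → Fin n → Fin n → Set
Reachable E = Star (λ u v → E u v ≡ true)

-- Identifier assignments: injective, of O(log n) bits, i.e. id v < n ^ k
ValidIds : (n k : ℕ) → (Fin n → ℕ) → Set
ValidIds n k ident = Injective _≡_ _≡_ ident × ((v : Fin n) → ident v < n ^ k)

lookupId : {n : ℕ} → (Fin n → ℕ) → ℕ → Maybe (Fin n)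
lookupId ident x with any? (λ u → ident u ≟ x)
... | yes (u , _) = just u
... | no _ = nothing

-- Initial local knowledge of a vertex: its own identifier, and for every
-- identifier x the pair (is there an edge self → x, is there an edge x → self).
-- Neighbours in N are exactly the identifiers with at least one `true`.
LocalView : Set
LocalView = ℕ × (ℕ → Bool × Bool)

view : {n : ℕ} → Digraph n → (Fin n → ℕ) → Fin n → LocalView
view E ident v =
  ident v , λ x → maybe (λ u → E v u , E u v) (false , false) (lookupId ident x)

-- Messages have O(log n) bits: a message is an element of Fin ((n+1)^c).
Msg : ℕ → ℕ → Set
Msg c n = Fin (suc n ^ c)

-- A deterministic one-round Broadcast CONGEST algorithm with message-size
-- exponent c.  The algorithm knows n.  Each vertex broadcasts one message
-- computed from its local view; after the round it computes its output from
-- its local view and the messages received from its neighbours (indexed by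
-- the neighbours' identifiers).  The output answers, for every ordered pair
-- of identifiers (x , y), whether y is reachable from x.
record OneRoundAlgorithm (c : ℕ) : Set where
  field
    send   : (n : ℕ) → LocalView → Msg c n
    output : (n : ℕ) → LocalView → (ℕ → Maybe (Msg c n)) → ℕ → ℕ → Bool

open OneRoundAlgorithm public

received : {c n : ℕ} → OneRoundAlgorithm c → Digraph n → (Fin n → ℕ) →
           Fin n → ℕ → Maybe (Msg c n)
received {c} {n} A E ident v x with lookupId ident x
... | nothing = nothing
... | just u  = if E v u ∨ E u v then just (send A n (view E ident u)) else nothing

runOutput : {c n : ℕ} → OneRoundAlgorithm c → Digraph n → (Fin n → ℕ) →
            Fin n → ℕ → ℕ → Bool
runOutput {c} {n} A E ident v =
  output A n (view E ident v) (received A E ident v)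

module Submission where

-- Call a digraph semicomplete if every two distinct vertices are joined
-- by an arc in at least one direction.  Every vertex u broadcasts its shifted
-- score  score u = indeg u + n ∸ outdeg u  (a number below (n+1)², so
-- O(log n) bits).  As every other vertex is a neighbour, after one round each
-- vertex knows all scores.  In a semicomplete digraph a vertex set T has no
-- arc leaving it iff
--     Σ_{u ∈ T} score u = n·|T| + |T|·|Tᶜ|                      (cut condition)
-- since Σ_{u∈T} (indeg u − outdeg u) counts arcs entering T minus arcs leaving
-- T, and there are at least |T|·|Tᶜ| arcs between T and Tᶜ.  Finally y is
-- reachable from x iff no out-closed set contains x but not y.  So a vertex
-- answers "y is reachable from x" iff no set of identifiers satisfying the cut
-- condition contains x but not y, which it decides by exhaustive search.

open import Defs
open import Data.Bool using (Bool; true; false; not; _∨_; if_then_else_)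
open import Data.Empty using (⊥-elim)
open import Data.Fin using (Fin; zero; suc; toℕ; fromℕ<; punchIn)
open import Data.Fin.Properties using (any?; toℕ-injective; toℕ-fromℕ<; punchInᵢ≢i)
  renaming (_≟_ to _≟ᶠ_)
open import Data.Fin.Subset using (Subset)
open import Data.Fin.Subset.Properties using (anySubset?)
open import Data.Maybe using (Maybe; just; nothing; maybe′)
import Data.Maybe as Maybe
open import Data.Nat using (ℕ; zero; suc; _+_; _*_; _∸_; _^_; _≤_; _<_; z≤n; s≤s)
open import Data.Nat.Properties
  using (+-*-semiring; module ≤-Reasoning; _≟_; _<?_; ≤-refl; ≤-trans; ≤∧≢⇒<;
         <-≤-trans; ≤-pred; <-irrefl; +-mono-≤; +-mono-<-≤; +-mono-≤-<; +-monoʳ-≤;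
         +-monoˡ-≤; +-comm; +-assoc; +-identityʳ; *-comm; *-identityʳ; *-distribˡ-+;
         +-cancelʳ-≡; m∸n+n≡m; m≤n+m; m∸n≤m; m≤m*n; n<1+n)
open import Algebra.Properties.Semiring.Sum +-*-semiring
  using (sum; sum-syntax; sum-cong-≗; sum-remove; sum-replicate-zero;
         ∑-comm; ∑-distrib-+; *-distribˡ-sum; *-distribʳ-sum)
open import Data.Product using (_×_; _,_; ∃; proj₁; proj₂)
open import Data.Sum using (_⊎_; inj₁; inj₂)
open import Data.Vec using (lookup; tabulate)
open import Data.Vec.Properties using (lookup∘tabulate)
open import Function using (_∘_)
open import Function.Bundles using (_⇔_; mk⇔; module Equivalence)
open import Function.Construct.Composition using (_⇔-∘_)
open import Function.Construct.Symmetry using (⇔-sym)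
open import Function.Definitions using (Injective)
open import Function.Related.TypeIsomorphisms using (¬-cong-⇔)
open import Relation.Binary.Construct.Closure.ReflexiveTransitive
  using (ε; _◅_; _◅◅_)
open import Relation.Binary.PropositionalEquality
  using (_≡_; _≢_; refl; sym; trans; cong; cong₂; module ≡-Reasoning)
open import Relation.Nullary using (Dec; yes; no; does; ¬_)
open import Relation.Nullary.Decidable using (_×-dec_; dec-true; dec-false)
import Data.Bool.Properties as Bool

-- (1) Finite sums of natural numbers

bit : Bool → ℕ
bit true  = 1
bit false = 0

bit≤1 : ∀ b → bit b ≤ 1
bit≤1 true  = ≤-refl
bit≤1 false = z≤n

sum-≤1 : ∀ {m} (f : Fin m → ℕ) → (∀ i → f i ≤ 1) → sum f ≤ m
sum-≤1 {zero}  f f≤1 = z≤n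
sum-≤1 {suc m} f f≤1 = +-mono-≤ (f≤1 zero) (sum-≤1 (f ∘ suc) (f≤1 ∘ suc))

sum-mono : ∀ {m} {f g : Fin m → ℕ} → (∀ i → f i ≤ g i) → sum f ≤ sum g
sum-mono {zero}  f≤g = z≤n
sum-mono {suc m} f≤g = +-mono-≤ (f≤g zero) (sum-mono (f≤g ∘ suc))

sum-strict : ∀ {m} {f g : Fin m → ℕ} → (∀ i → f i ≤ g i) →
             (j : Fin m) → f j < g j → sum f < sum g
sum-strict f≤g zero    fj<gj = +-mono-<-≤ fj<gj (sum-mono (f≤g ∘ suc))
sum-strict f≤g (suc j) fj<gj = +-mono-≤-< (f≤g zero) (sum-strict (f≤g ∘ suc) j fj<gj)

sum-tight : ∀ {m} {f g : Fin m → ℕ} → (∀ i → f i ≤ g i) → sum f ≡ sum g →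
            ∀ i → f i ≡ g i
sum-tight {f = f} {g} f≤g eq i with f i ≟ g i
... | yes fi≡gi = fi≡gi
... | no  fi≢gi = ⊥-elim (<-irrefl eq (sum-strict f≤g i (≤∧≢⇒< (f≤g i) fi≢gi)))

sum²-tight : ∀ {m p} {f g : Fin m → Fin p → ℕ} → (∀ i j → f i j ≤ g i j) →
             ∑[ i < m ] sum (f i) ≡ ∑[ i < m ] sum (g i) → ∀ i j → f i j ≡ g i j
sum²-tight f≤g eq i =
  sum-tight (f≤g i) (sum-tight (λ i → sum-mono (f≤g i)) eq i)

sum-single : ∀ {m} (f : Fin m → ℕ) (i₀ : Fin m) → (∀ i → i ≢ i₀ → f i ≡ 0) →
             sum f ≡ f i₀
sum-single {suc m} f i₀ vanish = begin
  sum f                              ≡⟨ sum-remove {i = i₀} f ⟩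
  f i₀ + ∑[ j < m ] f (punchIn i₀ j) ≡⟨ cong (f i₀ +_) rest≡0 ⟩
  f i₀ + 0                           ≡⟨ +-identityʳ (f i₀) ⟩
  f i₀                               ∎
  where
  open ≡-Reasoning
  rest≡0 : ∑[ j < m ] f (punchIn i₀ j) ≡ 0
  rest≡0 = trans (sum-cong-≗ (λ j → vanish (punchIn i₀ j) (punchInᵢ≢i i₀ j)))
                 (sum-replicate-zero m)

place : ∀ {m} → Fin m → Fin m → ℕ → ℕ
place j i c = if does (j ≟ᶠ i) then c else 0

place-here : ∀ {m} (i : Fin m) c → place i i c ≡ c
place-here i c rewrite dec-true (i ≟ᶠ i) refl = refl

place-elsewhere : ∀ {m} {j i : Fin m} c → j ≢ i → place j i c ≡ 0
place-elsewhere {j = j} {i} c j≢i rewrite dec-false (j ≟ᶠ i) j≢i = refl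

sum-injection : ∀ {m p} (ι : Fin m → Fin p) → Injective _≡_ _≡_ ι →
                (g : Fin p → ℕ) → (∀ i → (∀ u → ι u ≢ i) → g i ≡ 0) →
                sum g ≡ sum (g ∘ ι)
sum-injection {m} {p} ι ι-inj g off-image = begin
  ∑[ i < p ] g i                            ≡⟨ sum-cong-≗ fibre ⟩
  ∑[ i < p ] ∑[ u < m ] place (ι u) i (g i) ≡⟨ ∑-comm (λ i u → place (ι u) i (g i)) ⟩
  ∑[ u < m ] ∑[ i < p ] place (ι u) i (g i) ≡⟨ sum-cong-≗ collapse ⟩
  ∑[ u < m ] g (ι u)                        ∎
  where
  open ≡-Reasoning
  -- each g i is spread over the (at most one) preimage of i
  fibre : ∀ i → g i ≡ ∑[ u < m ] place (ι u) i (g i)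
  fibre i with any? (λ u → ι u ≟ᶠ i)
  ... | yes (u₀ , refl) = sym (trans
          (sum-single _ u₀ (λ u u≢u₀ → place-elsewhere (g (ι u₀)) (u≢u₀ ∘ ι-inj)))
          (place-here (ι u₀) (g (ι u₀))))
  ... | no  none = trans (off-image i (λ u e → none (u , e))) (sym (trans
          (sum-cong-≗ (λ u → place-elsewhere (g i) (λ e → none (u , e))))
          (sum-replicate-zero m)))
  collapse : ∀ u → ∑[ i < p ] place (ι u) i (g i) ≡ g (ι u)
  collapse u = trans (sum-single _ (ι u) (λ i i≢ιu → place-elsewhere (g i) (i≢ιu ∘ sym)))
                     (place-here (ι u) (g (ι u)))

-- (2) Out-closed sets and reachability in an arbitrary digraph

OutClosed : ∀ {n} → Digraph n → (Fin n → Bool) → Set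
OutClosed {n} E R = (a b : Fin n) → R a ≡ true → R b ≡ false → E a b ≡ false

Separated : ∀ {n} → Digraph n → Fin n → Fin n → Set
Separated E x y = ∃ λ R → OutClosed E R × R x ≡ true × R y ≡ false

closed-reach : ∀ {n} {E : Digraph n} {R : Fin n → Bool} → OutClosed E R →
               ∀ {a b} → R a ≡ true → Reachable E a b → R b ≡ true
closed-reach closed Ra ε = Ra
closed-reach {R = R} closed {a} Ra (_◅_ {j = c} Eac path) with R c in Rc
... | true  = closed-reach closed Rc path
... | false with () ← trans (sym Eac) (closed a c Ra Rc)

module _ {n : ℕ} (E : Digraph n) where

  outside : (Fin n → Bool) → ℕ
  outside R = ∑[ u < n ] bit (not (R u))

  insert : Fin n → (Fin n → Bool) → Fin n → Bool
  insert b R u = R u ∨ does (u ≟ᶠ b)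

  outside-insert : ∀ R b → R b ≡ false → outside (insert b R) < outside R
  outside-insert R b Rb = sum-strict shrinks b strictly
    where
    shrinks : ∀ u → bit (not (insert b R u)) ≤ bit (not (R u))
    shrinks u with R u | does (u ≟ᶠ b)
    ... | true  | _     = z≤n
    ... | false | true  = z≤n
    ... | false | false = ≤-refl
    strictly : bit (not (insert b R b)) < bit (not (R b))
    strictly rewrite Rb | dec-true (b ≟ᶠ b) refl = s≤s z≤n

  -- Starting from
  -- {x}, repeatedly add the head of an arc leaving the current set; every
  -- member stays reachable from x, and when no arc leaves, the set is
  -- out-closed.  The number of outside vertices bounds the recursion.
  reach-or-separate : ∀ x y → Reachable E x y ⊎ Separated E x y
  reach-or-separate x y =
    grow (suc n) singleton (s≤s (sum-≤1 _ (λ u → bit≤1 (not (singleton u)))))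
         (dec-true (x ≟ᶠ x) refl) singleton-reachable
    where
    singleton : Fin n → Bool
    singleton u = does (u ≟ᶠ x)

    singleton-reachable : ∀ u → singleton u ≡ true → Reachable E x u
    singleton-reachable u _ with u ≟ᶠ x
    singleton-reachable u _  | yes refl = ε
    singleton-reachable u () | no _

    Leaving : (Fin n → Bool) → Fin n → Fin n → Set
    Leaving R a b = R a ≡ true × R b ≡ false × E a b ≡ true

    leaving? : ∀ R a b → Dec (Leaving R a b)
    leaving? R a b = (R a Bool.≟ true) ×-dec ((R b Bool.≟ false) ×-dec (E a b Bool.≟ true))

    grow : ∀ fuel R → outside R < fuel → R x ≡ true →
           (∀ u → R u ≡ true → Reachable E x u) → Reachable E x y ⊎ Separated E x y
    grow (suc fuel) R bound Rx reachable with R y in Ry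
    ... | true  = inj₁ (reachable y Ry)
    ... | false with any? (λ a → any? (leaving? R a))
    ...   | yes (a , b , Ra , Rb , Eab) =
              grow fuel (insert b R) (<-≤-trans (outside-insert R b Rb) (≤-pred bound))
                   (cong (_∨ _) Rx) reachable′
      where
      reachable′ : ∀ u → insert b R u ≡ true → Reachable E x u
      reachable′ u _ with R u in Ru | u ≟ᶠ b
      reachable′ u _  | true  | _        = reachable u Ru
      reachable′ u _  | false | yes refl = reachable a Ra ◅◅ (Eab ◅ ε)
      reachable′ u () | false | no _
    ...   | no none = inj₂ (R , closed , Rx , Ry)
      where
      closed : OutClosed E R
      closed a b Ra Rb with E a b in Eab
      ... | false = refl
      ... | true  = ⊥-elim (none (a , b , Ra , Rb , Eab))

  reachable⇔unseparated : ∀ x y → Reachable E x y ⇔ (¬ Separated E x y)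
  reachable⇔unseparated x y = mk⇔ unseparated reachable
    where
    unseparated : Reachable E x y → ¬ Separated E x y
    unseparated path (R , closed , Rx , Ry) with () ← trans (sym Ry) (closed-reach closed Rx path)
    reachable : ¬ Separated E x y → Reachable E x y
    reachable ¬sep with reach-or-separate x y
    ... | inj₁ path = path
    ... | inj₂ sep  = ⊥-elim (¬sep sep)

-- (3) The cut condition in semicomplete digraphs

-- Every two distinct vertices are joined by an arc in some direction; this
-- is what underlying diameter 1 says beyond n ≥ 2.
Semicomplete : ∀ {n} → Digraph n → Set
Semicomplete {n} E = (u v : Fin n) → u ≢ v → (E u v ≡ true) ⊎ (E v u ≡ true)

adjacent : ∀ {n} {E : Digraph n} → Semicomplete E → ∀ {u v} → u ≢ v → E u v ∨ E v u ≡ true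
adjacent {E = E} semi {u} {v} u≢v with semi u v u≢v
... | inj₁ Euv rewrite Euv = refl
... | inj₂ Evu rewrite Evu = Bool.∨-zeroʳ (E u v)

-- A weight assigns a number to a vertex from its membership in a set and its
-- score.  Both the vertices (globally) and the identifiers (locally) give a
-- way to sum a weight, so the cut condition is stated for any summation.
Weight : Set
Weight = Bool → ℕ → ℕ

Cut : ℕ → (Weight → ℕ) → Set
Cut n Σw = Σw (λ b s → bit b * s)
         ≡ n * Σw (λ b _ → bit b) + Σw (λ b _ → bit b) * Σw (λ b _ → bit (not b))

Cut-cong : ∀ {n} {Σw Σw′ : Weight → ℕ} → (∀ w → Σw w ≡ Σw′ w) → Cut n Σw → Cut n Σw′
Cut-cong {n} same cut = trans (sym (same _))
  (trans cut (cong₂ (λ size coSize → n * size + size * coSize) (same _) (same _)))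

shifted-equation : ∀ {a o i m p : ℕ} → a + o ≡ i + m → (a ≡ m + p) ⇔ (i ≡ p + o)
shifted-equation {a} {o} {i} {m} {p} balance = mk⇔
  (λ a≡m+p → +-cancelʳ-≡ m i (p + o) (begin
     i + m       ≡⟨ sym balance ⟩
     a + o       ≡⟨ cong (_+ o) a≡m+p ⟩
     m + p + o   ≡⟨ rotate ⟩
     p + o + m   ∎))
  (λ i≡p+o → +-cancelʳ-≡ o a (m + p) (begin
     a + o       ≡⟨ balance ⟩
     i + m       ≡⟨ cong (_+ m) i≡p+o ⟩
     p + o + m   ≡⟨ sym rotate ⟩
     m + p + o   ∎))
  where
  open ≡-Reasoning
  rotate : m + p + o ≡ p + o + m
  rotate = trans (+-assoc m p o) (+-comm m (p + o))

module Scores {n : ℕ} (E : Digraph n) where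

  indeg outdeg : Fin n → ℕ
  indeg  u = ∑[ w < n ] bit (E w u)
  outdeg u = ∑[ w < n ] bit (E u w)

  -- shifted so that truncated subtraction is exact: outdeg u ≤ n
  score : Fin n → ℕ
  score u = indeg u + n ∸ outdeg u

  score+outdeg : ∀ u → score u + outdeg u ≡ indeg u + n
  score+outdeg u = m∸n+n≡m (≤-trans (sum-≤1 _ (λ w → bit≤1 (E u w))) (m≤n+m n (indeg u)))

  score-small : ∀ u → score u < suc n ^ 2
  score-small u = begin-strict
    score u         ≤⟨ m∸n≤m (indeg u + n) (outdeg u) ⟩
    indeg u + n     ≤⟨ +-monoˡ-≤ n (sum-≤1 _ (λ w → bit≤1 (E w u))) ⟩
    n + n           ≤⟨ +-monoʳ-≤ n (m≤m*n n (suc n)) ⟩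
    n + n * suc n   <⟨ n<1+n _ ⟩
    suc n * suc n   ≡⟨ cong (suc n *_) (sym (*-identityʳ (suc n))) ⟩
    suc n ^ 2       ∎
    where open ≤-Reasoning

  weighted : (Fin n → Bool) → Weight → ℕ
  weighted T w = ∑[ u < n ] w (T u) (score u)

  weighted-cong : ∀ {T T′} → (∀ u → T u ≡ T′ u) → ∀ w → weighted T w ≡ weighted T′ w
  weighted-cong T≗T′ w = sum-cong-≗ (λ u → cong (λ b → w b (score u)) (T≗T′ u))

  module _ (T : Fin n → Bool) where

    size coSize scoreSum inSum outSum : ℕ
    size     = ∑[ u < n ] bit (T u)
    coSize   = ∑[ u < n ] bit (not (T u))
    scoreSum = ∑[ u < n ] (bit (T u) * score u)
    inSum    = ∑[ u < n ] (bit (T u) * indeg u)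
    outSum   = ∑[ u < n ] (bit (T u) * outdeg u)

    degree-balance : scoreSum + outSum ≡ inSum + n * size
    degree-balance = begin
      scoreSum + outSum
        ≡⟨ sym (∑-distrib-+ (λ u → bit (T u) * score u) (λ u → bit (T u) * outdeg u)) ⟩
      ∑[ u < n ] (bit (T u) * score u + bit (T u) * outdeg u)
        ≡⟨ sum-cong-≗ pointwise ⟩
      ∑[ u < n ] (bit (T u) * indeg u + bit (T u) * n)
        ≡⟨ ∑-distrib-+ (λ u → bit (T u) * indeg u) (λ u → bit (T u) * n) ⟩
      inSum + ∑[ u < n ] (bit (T u) * n)
        ≡⟨ cong (inSum +_) (sym (*-distribʳ-sum n (λ u → bit (T u)))) ⟩
      inSum + size * n
        ≡⟨ cong (inSum +_) (*-comm size n) ⟩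
      inSum + n * size ∎
      where
      open ≡-Reasoning
      pointwise : ∀ u → bit (T u) * score u + bit (T u) * outdeg u
                      ≡ bit (T u) * indeg u + bit (T u) * n
      pointwise u = begin
        bit (T u) * score u + bit (T u) * outdeg u ≡⟨ sym (*-distribˡ-+ (bit (T u)) _ _) ⟩
        bit (T u) * (score u + outdeg u)          ≡⟨ cong (bit (T u) *_) (score+outdeg u) ⟩
        bit (T u) * (indeg u + n)                 ≡⟨ *-distribˡ-+ (bit (T u)) _ _ ⟩
        bit (T u) * indeg u + bit (T u) * n       ∎

    entering : Fin n → Fin n → ℕ
    entering u w = bit (T u) * bit (E w u)

    crossing leaving : Fin n → Fin n → ℕ
    crossing u w = bit (T u) * bit (not (T w))
    leaving  u w = bit (T w) * bit (E w u)

    -- an upper bound for `entering`: one arc per crossing pair, plus the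
    -- arcs out of members; its total is |T|·|Tᶜ| + Σ_T outdeg
    allowance : Fin n → Fin n → ℕ
    allowance u w = crossing u w + leaving u w

    entering≤allowance : ∀ u w → entering u w ≤ allowance u w
    entering≤allowance u w with T u | T w | E w u
    ... | true  | true  | _     = ≤-refl
    ... | true  | false | true  = ≤-refl
    ... | true  | false | false = z≤n
    ... | false | _     | _     = z≤n

    inSum-as-arcs : inSum ≡ ∑[ u < n ] ∑[ w < n ] entering u w
    inSum-as-arcs = sum-cong-≗ (λ u → *-distribˡ-sum (bit (T u)) (λ w → bit (E w u)))

    pairs+outSum-as-arcs : size * coSize + outSum ≡ ∑[ u < n ] ∑[ w < n ] allowance u w
    pairs+outSum-as-arcs = begin
      size * coSize + outSum
        ≡⟨ cong₂ _+_ pairs arcs ⟩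
      ∑[ u < n ] sum (crossing u) + ∑[ u < n ] sum (leaving u)
        ≡⟨ sym (∑-distrib-+ (λ u → sum (crossing u)) (λ u → sum (leaving u))) ⟩
      ∑[ u < n ] (sum (crossing u) + sum (leaving u))
        ≡⟨ sum-cong-≗ (λ u → sym (∑-distrib-+ (crossing u) (leaving u))) ⟩
      ∑[ u < n ] ∑[ w < n ] allowance u w ∎
      where
      open ≡-Reasoning
      pairs : size * coSize ≡ ∑[ u < n ] sum (crossing u)
      pairs = trans (*-distribʳ-sum coSize (λ u → bit (T u)))
        (sum-cong-≗ (λ u → *-distribˡ-sum (bit (T u)) (λ w → bit (not (T w)))))
      arcs : outSum ≡ ∑[ u < n ] sum (leaving u)
      arcs = trans (sum-cong-≗ (λ w → *-distribˡ-sum (bit (T w)) (λ u → bit (E w u))))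
                   (∑-comm (λ w u → bit (T w) * bit (E w u)))

    cut⇔tight : Cut n (weighted T) ⇔ (∀ u w → entering u w ≡ allowance u w)
    cut⇔tight = mk⇔
      (λ cut → sum²-tight entering≤allowance
         (trans (sym inSum-as-arcs) (trans (to balanced cut) pairs+outSum-as-arcs)))
      (λ tight → from balanced (trans inSum-as-arcs (trans
         (sum-cong-≗ (λ u → sum-cong-≗ (tight u))) (sym pairs+outSum-as-arcs))))
      where
      open Equivalence
      balanced = shifted-equation {p = size * coSize} degree-balance

    tight⇒closed : (∀ u w → entering u w ≡ allowance u w) → OutClosed E T
    tight⇒closed tight a b Ta Tb with E a b in Eab
    ... | false = refl
    ... | true  = ⊥-elim (arc-beyond-allowance Ta Tb Eab (tight b a))
      where
      arc-beyond-allowance : ∀ {p q r} → p ≡ true → q ≡ false → r ≡ true →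
                             bit q * bit r ≢ bit q * bit (not p) + bit p * bit r
      arc-beyond-allowance refl refl refl ()

    closed⇒tight : Semicomplete E → OutClosed E T → ∀ u w → entering u w ≡ allowance u w
    closed⇒tight semi closed u w with T u in Tu | T w in Tw | E w u in Ewu
    ... | true  | true  | true  = refl
    ... | true  | true  | false = refl
    ... | false | false | _     = refl
    ... | false | true  | false = refl
    ... | false | true  | true  with () ← trans (sym Ewu) (closed w u Tw Tu)
    ... | true  | false | true  = refl
    ... | true  | false | false with semi u w (λ { refl → distinct (trans (sym Tu) Tw) })
      where distinct : true ≢ false
            distinct ()
    ...   | inj₁ Euw with () ← trans (sym Euw) (closed u w Tu Tw)
    ...   | inj₂ Ewu′ with () ← trans (sym Ewu′) Ewu

    cut⇔closed : Semicomplete E → Cut n (weighted T) ⇔ OutClosed E T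
    cut⇔closed semi = mk⇔ (tight⇒closed ∘ to cut⇔tight)
                          (from cut⇔tight ∘ closed⇒tight semi)
      where open Equivalence

-- (4) Sums over identifiers versus sums over vertices

data LookupView {n : ℕ} (ident : Fin n → ℕ) (z : ℕ) : Maybe (Fin n) → Set where
  found  : ∀ u → ident u ≡ z → LookupView ident z (just u)
  absent : (∀ u → ident u ≢ z) → LookupView ident z nothing

lookupId-view : ∀ {n} (ident : Fin n → ℕ) z → LookupView ident z (lookupId ident z)
lookupId-view ident z with any? (λ u → ident u ≟ z)
... | yes (u , e) = found u e
... | no  none    = absent (λ u e → none (u , e))

lookupId-self : ∀ {n} {ident : Fin n → ℕ} → Injective _≡_ _≡_ ident →
                ∀ u → lookupId ident (ident u) ≡ just u
lookupId-self {ident = ident} inj u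
  with lookupId ident (ident u) | lookupId-view ident (ident u)
... | just w  | found .w e  = cong just (inj e)
... | nothing | absent none = ⊥-elim (none u refl)

memberId : ∀ {N} → Subset N → ℕ → Bool
memberId {N} T z with z <? N
... | yes z<N = lookup T (fromℕ< z<N)
... | no  _   = false

module Identifiers {n N : ℕ} (ident : Fin n → ℕ) (inj : Injective _≡_ _≡_ ident)
                   (small : ∀ u → ident u < N) where

  slot : Fin n → Fin N
  slot u = fromℕ< (small u)

  sum-over-ids : (h : ℕ → Maybe (Fin n) → ℕ) → (∀ z → h z nothing ≡ 0) →
                 ∑[ i < N ] h (toℕ i) (lookupId ident (toℕ i)) ≡ ∑[ u < n ] h (ident u) (just u)
  sum-over-ids h h-absent =
    trans (sum-injection slot slot-injective g off-image) (sum-cong-≗ at-slot)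
    where
    g : Fin N → ℕ
    g i = h (toℕ i) (lookupId ident (toℕ i))
    slot-injective : Injective _≡_ _≡_ slot
    slot-injective {u} {w} e =
      inj (trans (sym (toℕ-fromℕ< (small u))) (trans (cong toℕ e) (toℕ-fromℕ< (small w))))
    at-slot : ∀ u → g (slot u) ≡ h (ident u) (just u)
    at-slot u rewrite toℕ-fromℕ< (small u) | lookupId-self inj u = refl
    off-image : ∀ i → (∀ u → slot u ≢ i) → g i ≡ 0
    off-image i not-slot with lookupId ident (toℕ i) | lookupId-view ident (toℕ i)
    ... | just u  | found .u e = ⊥-elim (not-slot u (toℕ-injective (trans (toℕ-fromℕ< (small u)) e)))
    ... | nothing | absent _   = h-absent (toℕ i)

  idSet : (Fin n → Bool) → Subset N
  idSet R = tabulate (λ i → maybe′ R false (lookupId ident (toℕ i)))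

  memberId-idSet : ∀ R u → memberId (idSet R) (ident u) ≡ R u
  memberId-idSet R u with ident u <? N
  ... | no  ¬small = ⊥-elim (¬small (small u))
  ... | yes u<N
    rewrite lookup∘tabulate (λ i → maybe′ R false (lookupId ident (toℕ i))) (fromℕ< u<N)
          | toℕ-fromℕ< u<N | lookupId-self inj u = refl

-- (5) The algorithm and its correctness

-- Identifiers lie below n ^ k.
module Algorithm (k : ℕ) where

  localOutdeg localIndeg localScore : ℕ → LocalView → ℕ
  localOutdeg n (_ , arcs) = ∑[ i < n ^ k ] bit (proj₁ (arcs (toℕ i)))
  localIndeg  n (_ , arcs) = ∑[ i < n ^ k ] bit (proj₂ (arcs (toℕ i)))
  localScore  n lv         = localIndeg n lv + n ∸ localOutdeg n lv

  -- a number as a message; exact below (n+1)²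
  encode : (n d : ℕ) → Msg 2 n
  encode n d with d <? suc n ^ 2
  ... | yes d<bound = fromℕ< d<bound
  ... | no  _       = zero

  encode-exact : ∀ n d → d < suc n ^ 2 → toℕ (encode n d) ≡ d
  encode-exact n d d<bound with d <? suc n ^ 2
  ... | yes d<bound′ = toℕ-fromℕ< d<bound′
  ... | no  d≮bound  = ⊥-elim (d≮bound d<bound)

  Inbox : ℕ → Set
  Inbox n = ℕ → Maybe (Msg 2 n)

  knownScore : (n : ℕ) → LocalView → Inbox n → ℕ → Maybe ℕ
  knownScore n lv inbox z =
    if does (z ≟ proj₁ lv) then just (localScore n lv) else Maybe.map toℕ (inbox z)

  knownScore-self : ∀ n lv inbox → knownScore n lv inbox (proj₁ lv) ≡ just (localScore n lv)
  knownScore-self n lv inbox rewrite dec-true (proj₁ lv ≟ proj₁ lv) refl = refl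

  knownScore-other : ∀ n lv inbox {z} → z ≢ proj₁ lv →
                     knownScore n lv inbox z ≡ Maybe.map toℕ (inbox z)
  knownScore-other n lv inbox {z} z≢me rewrite dec-false (z ≟ proj₁ lv) z≢me = refl

  localWeighted : (n : ℕ) → LocalView → Inbox n → Subset (n ^ k) → Weight → ℕ
  localWeighted n lv inbox T w =
    ∑[ i < n ^ k ] maybe′ (w (memberId T (toℕ i))) 0 (knownScore n lv inbox (toℕ i))

  LocalSeparator : (n : ℕ) → LocalView → Inbox n → ℕ → ℕ → Subset (n ^ k) → Set
  LocalSeparator n lv inbox x y T =
    memberId T x ≡ true × memberId T y ≡ false × Cut n (localWeighted n lv inbox T)

  localSeparator? : ∀ n lv inbox x y T → Dec (LocalSeparator n lv inbox x y T)
  localSeparator? n lv inbox x y T =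
    (memberId T x Bool.≟ true) ×-dec ((memberId T y Bool.≟ false) ×-dec (_ ≟ _))

  reachability : OneRoundAlgorithm 2
  reachability = record
    { send   = λ n lv → encode n (localScore n lv)
    ; output = λ n lv inbox x y → not (does (anySubset? (localSeparator? n lv inbox x y)))
    }

module Correctness (k : ℕ) {n : ℕ} (E : Digraph n) (semi : Semicomplete E)
                   (ident : Fin n → ℕ) (valid : ValidIds n k ident) where
  open Algorithm k
  open Scores E
  open Identifiers ident (proj₁ valid) (proj₂ valid)

  viewAt : Fin n → LocalView
  viewAt v = view E ident v

  inboxAt : Fin n → Inbox n
  inboxAt v = received reachability E ident v

  localScore-correct : ∀ u → localScore n (viewAt u) ≡ score u
  localScore-correct u = cong₂ (λ i o → i + n ∸ o)
    (sum-over-ids (λ _ m → bit (proj₂ (maybe′ (λ w → E u w , E w u) (false , false) m))) (λ _ → refl))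
    (sum-over-ids (λ _ m → bit (proj₁ (maybe′ (λ w → E u w , E w u) (false , false) m))) (λ _ → refl))

  -- every other vertex is a neighbour, so v learns every score
  knownScore-correct : ∀ v z →
    knownScore n (viewAt v) (inboxAt v) z ≡ Maybe.map score (lookupId ident z)
  knownScore-correct v z with z ≟ ident v
  ... | yes refl = begin
    knownScore n (viewAt v) (inboxAt v) (ident v) ≡⟨ knownScore-self n (viewAt v) (inboxAt v) ⟩
    just (localScore n (viewAt v))                ≡⟨ cong just (localScore-correct v) ⟩
    just (score v)                                ≡⟨ cong (Maybe.map score) (lookupId-self (proj₁ valid) v) ⟨
    Maybe.map score (lookupId ident (ident v))    ∎
    where open ≡-Reasoning
  ... | no  z≢v rewrite knownScore-other n (viewAt v) (inboxAt v) z≢v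
    with lookupId ident z | lookupId-view ident z
  ...   | nothing | absent _    = refl
  ...   | just u  | found .u refl
    rewrite adjacent semi {v} {u} (λ v≡u → z≢v (cong ident (sym v≡u))) =
      cong just (trans (cong (toℕ ∘ encode n) (localScore-correct u)) (encode-exact n _ (score-small u)))

  localWeighted-correct : ∀ v T w →
    localWeighted n (viewAt v) (inboxAt v) T w
      ≡ weighted (λ u → memberId T (ident u)) w
  localWeighted-correct v T w = begin
    localWeighted n (viewAt v) (inboxAt v) T w
      ≡⟨ sum-cong-≗ {n ^ k} known ⟩
    ∑[ i < n ^ k ] maybe′ (λ u → w (memberId T (toℕ i)) (score u)) 0 (lookupId ident (toℕ i))
      ≡⟨ sum-over-ids (λ z m → maybe′ (λ u → w (memberId T z) (score u)) 0 m) (λ _ → refl) ⟩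
    weighted (λ u → memberId T (ident u)) w ∎
    where
    open ≡-Reasoning
    known : ∀ i → maybe′ (w (memberId T (toℕ i))) 0
                    (knownScore n (viewAt v) (inboxAt v) (toℕ i))
                ≡ maybe′ (λ u → w (memberId T (toℕ i)) (score u)) 0 (lookupId ident (toℕ i))
    known i rewrite knownScore-correct v (toℕ i) with lookupId ident (toℕ i)
    ... | just _  = refl
    ... | nothing = refl

  separator⇔separated : ∀ v x y →
    ∃ (LocalSeparator n (viewAt v) (inboxAt v) (ident x) (ident y))
      ⇔ Separated E x y
  separator⇔separated v x y = mk⇔ separating local
    where
    open Equivalence
    separating : ∃ (LocalSeparator n (viewAt v) (inboxAt v) (ident x) (ident y)) → Separated E x y
    separating (T , Tx , Ty , cut) =
      (λ u → memberId T (ident u)) ,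
      to (cut⇔closed _ semi) (Cut-cong {n} (localWeighted-correct v T) cut) , Tx , Ty
    local : Separated E x y → ∃ (LocalSeparator n (viewAt v) (inboxAt v) (ident x) (ident y))
    local (R , closed , Rx , Ry) =
      idSet R , trans (memberId-idSet R x) Rx , trans (memberId-idSet R y) Ry ,
      Cut-cong {n} (λ w → sym (trans (localWeighted-correct v (idSet R) w)
                                 (weighted-cong (memberId-idSet R) w)))
               (from (cut⇔closed R semi) closed)

not-does⇔¬ : ∀ {X : Set} (d : Dec X) → (not (does d) ≡ true) ⇔ (¬ X)
not-does⇔¬ (yes x) = mk⇔ (λ ()) (λ ¬x → ⊥-elim (¬x x))
not-does⇔¬ (no ¬x) = mk⇔ (λ _ → ¬x) (λ _ → refl)

-- Diameter 1 is used only
-- through semicompleteness; self-loops would not matter.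
corollary3 : (k : ℕ) → ∃ λ c → ∃ λ (A : OneRoundAlgorithm c) →
    (n : ℕ) (E : Digraph n) → Simple E → UnderlyingDiameter1 E →
    (ident : Fin n → ℕ) → ValidIds n k ident →
    (v x y : Fin n) →
      (runOutput A E ident v (ident x) (ident y) ≡ true) ⇔ Reachable E x y
corollary3 k = 2 , Algorithm.reachability k ,
  λ n E _ (_ , semi) ident valid v x y →
    let open Algorithm k
        open Correctness k E semi ident valid
    in  ⇔-sym (reachable⇔unseparated E x y)
          ⇔-∘ (¬-cong-⇔ (separator⇔separated v x y)
          ⇔-∘ not-does⇔¬ (anySubset? (localSeparator? n (viewAt v) (inboxAt v) (ident x) (ident y))))
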